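{- Let $T$ be a finite tree with $\Delta(T)\le 4$ and let $\mathcal{M}$ be an s-model of $T$. If the ordered pair $(p,v)$ is critical in $\mathcal{M}$, then $b(T)\ge b^{\ell}_{\mathcal{M}}(p,v)$.
   Context: Grid: the rectangular grid whose grid lines are the horizontal and vertical lines through integer points. An s-model of a tree $T$ with $\Delta(T)\le 4$ is a drawing of $T$ in the grid in which each vertex is a distinct grid point and each edge is a straight (bend-free) horizontal or vertical grid segment joining its endpoints, segments of distinct edges meeting only at common endpoints; $\mathcal{M}(T)$ is the set of s-models. The number of bends of a path $Q$ of $T$ in $\mathcal{M}$ is the number of turns between horizontal and vertical of the grid path formed by concatenating the segments of the edges of $Q$. $b_{\mathcal{M}}(u,w)$ is the number of bends of the $u$–$w$ path; $b(\mathcal{M})=\max\{b_{\mathcal{M}}(u,w): u,w \text{ leaves of } T\}$ and $b(T)=\min\{b(\mathcal{M}):\mathcal{M}\in\mathcal{M}(T)\}$. For $p,v\in V(T)$, $b^{\ell}_{\mathcal{M}}(p,v)=\max\{b_{\mathcal{M}}(p,f): f \text{ a leaf of } T \text{ whose path from } p \text{ contains } v\}$. For $(p,v)\in E(T)$, list $N(v)\setminus\{p\}$ padded with virtual neighbours $\emptyset$ to three entries $u^1_{\mathcal{M}}(p,v),u^2_{\mathcal{M}}(p,v),u^3_{\mathcal{M}}(p,v)$, with $b^i_{\mathcal{M}}(p,v)=b^{\ell}_{\mathcal{M}}(v,u^i_{\mathcal{M}}(p,v))$ for real neighbours and $-1$ for virtual ones, ordered so that $b^1_{\mathcal{M}}(p,v)\ge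 b^2_{\mathcal{M}}(p,v)\ge b^3_{\mathcal{M}}(p,v)$. An ordered pair $(p,v)$ is critical in $\mathcal{M}$ if either $v=\emptyset$, or $(p,v)\in E(T)$ and either (a) $b^{\ell}_{\mathcal{M}}(p,v)=b^1_{\mathcal{M}}(p,v)$ and $(v,u^1_{\mathcal{M}}(p,v))$ is critical, or (b) $b^{\ell}_{\mathcal{M}}(p,v)=b^2_{\mathcal{M}}(p,v)+1$ and both $(v,u^1_{\mathcal{M}}(p,v))$, $(v,u^2_{\mathcal{M}}(p,v))$ are critical (recursive definition). -}

module Defs where

open import Data.Nat using (ℕ; zero; suc; _+_; _≤_)
open import Data.Integer as ℤ using (ℤ; +_; -[1+_])
open import Data.Fin using (Fin)
open import Data.Fin.Base using () 
open import Data.List using (List; []; _∷_; length; filterᵇ; allFin)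
open import Data.List.Relation.Unary.Unique.Propositional using (Unique)
open import Data.List.Membership.Propositional using (_∈_)
open import Data.Maybe using (Maybe; just; nothing)
open import Data.Bool using (Bool; T; _xor_; if_then_else_)
open import Data.Product using (Σ; ∃; ∃-syntax; _×_; _,_; proj₁; proj₂)
open import Data.Sum using (_⊎_)
open import Data.Empty using (⊥)
open import Relation.Nullary using (¬_)
open import Relation.Nullary.Decidable using (⌊_⌋)
open import Relation.Binary.PropositionalEquality using (_≡_; _≢_)

-- Generic: maximum / minimum of a set of naturals (given as a predicate).
-- The maximum of the empty set is taken to be 0 (only relevant for the
-- degenerate one-vertex tree, which has no leaves).

IsMax : (ℕ → Set) → ℕ → Set
IsMax S k = (∀ j → S j → j ≤ k) × (S k ⊎ ((k ≡ 0) × (∀ j → ¬ S j)))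

IsMin : (ℕ → Set) → ℕ → Set
IsMin S k = S k × (∀ j → S j → k ≤ j)

module _ {n : ℕ} (adj : Fin n → Fin n → Bool) where

  Adj : Fin n → Fin n → Set
  Adj u w = T (adj u w)

  data Walk : Fin n → Fin n → List (Fin n) → Set where
    here  : ∀ {u} → Walk u u (u ∷ [])
    there : ∀ {u x w xs} → Adj u x → Walk x w xs → Walk u w (u ∷ xs)

  IsPath : Fin n → Fin n → List (Fin n) → Set
  IsPath u w xs = Walk u w xs × Unique xs

  degree : Fin n → ℕ
  degree v = length (filterᵇ (adj v) (allFin n))

  IsLeaf : Fin n → Set
  IsLeaf v = degree v ≡ 1

record Tree : Set where
  field
    n         : ℕ
    adj       : Fin n → Fin n → Bool
    adj-sym   : ∀ u w → Adj adj u w → Adj adj w u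
    adj-irr   : ∀ u → ¬ Adj adj u u
    nonempty  : 1 ≤ n
    connected : ∀ u w → ∃[ xs ] IsPath adj u w xs
    acyclic   : ∀ u w xs → IsPath adj u w xs → 3 ≤ length xs → ¬ Adj adj w u

MaxDeg≤4 : Tree → Set
MaxDeg≤4 T = ∀ v → degree (Tree.adj T) v ≤ 4

Point : Set
Point = ℤ × ℤ

Between : ℤ → ℤ → ℤ → Set
Between a b c = ((a ℤ.≤ c) × (c ℤ.≤ b)) ⊎ ((b ℤ.≤ c) × (c ℤ.≤ a))

OnSeg : Point → Point → Point → Set
OnSeg a b q = Between (proj₁ a) (proj₁ b) (proj₁ q) × Between (proj₂ a) (proj₂ b) (proj₂ q)

-- s-models.  Two axis-parallel segments with integer endpoints meet in a
-- non-endpoint point iff they meet in such a grid point, so it suffices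
-- to quantify over grid points q.
record SModel (Tr : Tree) : Set where
  open Tree Tr
  field
    pos      : Fin n → Point
    pos-inj  : ∀ u w → pos u ≡ pos w → u ≡ w
    straight : ∀ u w → Adj adj u w →
               (proj₁ (pos u) ≡ proj₁ (pos w)) ⊎ (proj₂ (pos u) ≡ proj₂ (pos w))
    meet     : ∀ a b c d q → Adj adj a b → Adj adj c d →
               ¬ (((a ≡ c) × (b ≡ d)) ⊎ ((a ≡ d) × (b ≡ c))) →
               OnSeg (pos a) (pos b) q → OnSeg (pos c) (pos d) q →
               ∃[ x ] (((x ≡ a) ⊎ (x ≡ b)) × ((x ≡ c) ⊎ (x ≡ d)) × (q ≡ pos x))

module _ {Tr : Tree} (M : SModel Tr) where
  open Tree Tr
  open SModel M

  isHor : Fin n → Fin n → Bool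
  isHor a b = ⌊ proj₂ (pos a) ℤ.≟ proj₂ (pos b) ⌋

  bends : List (Fin n) → ℕ
  bends (a ∷ b ∷ c ∷ xs) = (if isHor a b xor isHor b c then 1 else 0) + bends (b ∷ c ∷ xs)
  bends _ = 0

  -- the set { b_M(u,w) : u,w leaves }  (paths in a tree are unique)
  LeafPairBends : ℕ → Set
  LeafPairBends k = ∃[ u ] ∃[ w ] ∃[ xs ]
    (IsLeaf adj u × IsLeaf adj w × IsPath adj u w xs × (bends xs ≡ k))

  IsBModel : ℕ → Set
  IsBModel = IsMax LeafPairBends

  LeafBendsVia : Fin n → Fin n → ℕ → Set
  LeafBendsVia p v k = ∃[ f ] ∃[ xs ]
    (IsLeaf adj f × IsPath adj p f xs × (v ∈ xs) × (bends xs ≡ k))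

  -- b^ℓ_M(p,v) = k  (integer valued; a virtual neighbour ∅ has value -1)
  BL : Fin n → Maybe (Fin n) → ℤ → Set
  BL p nothing  k = k ≡ -[1+ 0 ]
  BL p (just v) k = ∃[ m ] ((k ≡ + m) × IsMax (LeafBendsVia p v) m)

  -- u1,u2,u3 is N(v)∖{p} padded with virtual neighbours (nothing)
  record Padding (p v : Fin n) (u1 u2 u3 : Maybe (Fin n)) : Set where
    field
      sound    : ∀ w → (just w ≡ u1) ⊎ (just w ≡ u2) ⊎ (just w ≡ u3) →
                 Adj adj v w × (w ≢ p)
      complete : ∀ w → Adj adj v w → w ≢ p →
                 (just w ≡ u1) ⊎ (just w ≡ u2) ⊎ (just w ≡ u3)
      dist12   : ∀ w → just w ≡ u1 → ¬ (just w ≡ u2)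
      dist13   : ∀ w → just w ≡ u1 → ¬ (just w ≡ u3)
      dist23   : ∀ w → just w ≡ u2 → ¬ (just w ≡ u3)

  record Ordering (p v : Fin n) (u1 u2 u3 : Maybe (Fin n)) (b1 b2 b3 : ℤ) : Set where
    field
      padding : Padding p v u1 u2 u3
      val1    : BL v u1 b1
      val2    : BL v u2 b2
      val3    : BL v u3 b3
      ord12   : b2 ℤ.≤ b1
      ord23   : b3 ℤ.≤ b2

  -- critical ordered pairs (p,v), v possibly virtual.  The ordering of
  -- tied neighbours is an arbitrary choice, quantified existentially at
  -- each step.
  data Critical : Fin n → Maybe (Fin n) → Set where
    crit-∅ : ∀ {p} → Critical p nothing
    crit-a : ∀ {p v} u1 u2 u3 (k b1 b2 b3 : ℤ) →
             Adj adj p v → Ordering p v u1 u2 u3 b1 b2 b3 →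
             BL p (just v) k → k ≡ b1 →
             Critical v u1 → Critical p (just v)
    crit-b : ∀ {p v} u1 u2 u3 (k b1 b2 b3 : ℤ) →
             Adj adj p v → Ordering p v u1 u2 u3 b1 b2 b3 →
             BL p (just v) k → k ≡ b2 ℤ.+ + 1 →
             Critical v u1 → Critical v u2 → Critical p (just v)

IsBTree : Tree → ℕ → Set
IsBTree Tr = IsMin (λ k → ∃[ M ] IsBModel {Tr} M k)

-- Following the critical recursion in M, one builds in ANY s-model N a path
-- from p through v to a leaf with at least b^ℓ_M(p,v) bends.  In case (a)
-- the path continues through u¹.  In case (b) the edges from v to p, u¹, u²
-- cannot all be parallel, since two of the three collinear neighbours would
-- lie on the same side of v and their edges would overlap; so the path turns
-- at v towards u¹ or u², gaining a bend on top of at least b² bends.  Extending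
-- the path backwards from p to a leaf yields two leaves joined by a path with
-- at least b^ℓ_M(p,v) bends in N, whence b(N) ≥ b^ℓ_M(p,v) for every N.
module Submission where

open import Defs
open import Data.Bool using (true; false; _xor_)
open import Data.Bool.Properties using () renaming (_≟_ to _≟ᵇ_)
open import Data.Empty using (⊥; ⊥-elim)
open import Data.Fin using (Fin; zero; suc)
open import Data.Fin.Properties using (injective⇒≤)
open import Data.Integer as ℤ using (ℤ; +_; +≤+; -≤+; _≤_)
import Data.Integer.Properties as ℤ
open import Data.List using (List; []; _∷_; [_]; _++_; length; lookup; filterᵇ; allFin)
open import Data.List.Properties using (++-assoc)
open import Data.List.Membership.Propositional using (_∈_; _∉_)
open import Data.List.Membership.Propositional.Properties using (∈-allFin; ∈-lookup; ∈-filter⁺; ∈-filter⁻)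
open import Data.List.Relation.Unary.All using (_∷_)
open import Data.List.Relation.Unary.All.Properties using (++⁻ˡ)
open import Data.List.Relation.Unary.All.Properties.Core using (¬Any⇒All¬)
open import Data.List.Relation.Unary.AllPairs using ([]; _∷_)
open import Data.List.Relation.Unary.Any using (here; there)
open import Data.List.Relation.Unary.Unique.Propositional using (Unique)
open import Data.List.Relation.Unary.Unique.Propositional.Properties using (allFin⁺; filter⁺; Unique[x∷xs]⇒x∉xs)
open import Data.Maybe using (Maybe; just; nothing)
open import Data.Nat as ℕ using (ℕ; zero; suc; _<_; z≤n; s≤s)
import Data.Nat.Properties as ℕ
open import Data.Product using (∃-syntax; _×_; _,_; proj₁; proj₂)
open import Data.Sum using (_⊎_; inj₁; inj₂)
open import Function using (_∘_)
open import Relation.Binary.PropositionalEquality using (_≡_; _≢_; refl; sym; trans; cong; subst; ≢-sym)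
open import Relation.Nullary using (¬_; yes; no)
open import Relation.Nullary.Decidable using (T?)

module _ {A : Set} where

  unique-++⁻ˡ : ∀ xs {ys : List A} → Unique (xs ++ ys) → Unique xs
  unique-++⁻ˡ []       _         = []
  unique-++⁻ˡ (x ∷ xs) (x∉ ∷ u) = ++⁻ˡ xs x∉ ∷ unique-++⁻ˡ xs u

  unique-∷ : ∀ {x : A} {xs} → x ∉ xs → Unique xs → Unique (x ∷ xs)
  unique-∷ {xs = xs} x∉xs u = ¬Any⇒All¬ xs x∉xs ∷ u

  lookup-injective : ∀ {xs : List A} → Unique xs → ∀ i j → lookup xs i ≡ lookup xs j → i ≡ j
  lookup-injective (_ ∷ _)   zero    zero    _ = refl
  lookup-injective u@(_ ∷ _) zero    (suc j) e = ⊥-elim (Unique[x∷xs]⇒x∉xs u (subst (_∈ _) (sym e) (∈-lookup j)))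
  lookup-injective u@(_ ∷ _) (suc i) zero    e = ⊥-elim (Unique[x∷xs]⇒x∉xs u (subst (_∈ _) e (∈-lookup i)))
  lookup-injective (_ ∷ u)   (suc i) (suc j) e = cong suc (lookup-injective u i j e)

  anotherMember : ∀ {xs : List A} {s} → Unique xs → length xs ≢ 1 → s ∈ xs → ∃[ y ] (y ∈ xs × y ≢ s)
  anotherMember {_ ∷ []}    _                 len≢1 _                     = ⊥-elim (len≢1 refl)
  anotherMember {_ ∷ _ ∷ _} ((x≢y ∷ _) ∷ _)   _     (here refl)           = _ , there (here refl) , x≢y ∘ sym
  anotherMember {_ ∷ _ ∷ _} ((x≢y ∷ _) ∷ _)   _     (there (here refl))   = _ , here refl , x≢y
  anotherMember {_ ∷ _ ∷ _} u                 _     (there (there s∈zs)) =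
    _ , here refl , λ { refl → Unique[x∷xs]⇒x∉xs u (there s∈zs) }

unique⇒length≤ : ∀ {n} {xs : List (Fin n)} → Unique xs → length xs ℕ.≤ n
unique⇒length≤ u = injective⇒≤ (λ {i} {j} → lookup-injective u i j)

Between-right : ∀ a b → Between a b b
Between-right a b with ℤ.≤-total a b
... | inj₁ a≤b = inj₁ (a≤b , ℤ.≤-refl)
... | inj₂ b≤a = inj₂ (ℤ.≤-refl , b≤a)

Between-≡ : ∀ {a b c} → c ≡ a → b ≡ a → Between a b c
Between-≡ {a} refl refl = Between-right a a

SameSide : ℤ → ℤ → ℤ → Set
SameSide v a b = (v ≤ a × v ≤ b) ⊎ (a ≤ v × b ≤ v)

Nested : ℤ → ℤ → ℤ → Set
Nested v a b = Between v b a ⊎ Between v a b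

sameSide⇒nested : ∀ {v a b} → SameSide v a b → Nested v a b
sameSide⇒nested {a = a} {b} (inj₁ (v≤a , v≤b)) with ℤ.≤-total a b
... | inj₁ a≤b = inj₁ (inj₁ (v≤a , a≤b))
... | inj₂ b≤a = inj₂ (inj₁ (v≤b , b≤a))
sameSide⇒nested {a = a} {b} (inj₂ (a≤v , b≤v)) with ℤ.≤-total a b
... | inj₁ a≤b = inj₂ (inj₂ (a≤b , b≤v))
... | inj₂ b≤a = inj₁ (inj₂ (b≤a , a≤v))

twoOnSameSide : ∀ v a b c → SameSide v a b ⊎ SameSide v a c ⊎ SameSide v b c
twoOnSameSide v a b c with ℤ.≤-total v a | ℤ.≤-total v b | ℤ.≤-total v c
... | inj₁ v≤a | inj₁ v≤b | _        = inj₁ (inj₁ (v≤a , v≤b))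
... | inj₂ a≤v | inj₂ b≤v | _        = inj₁ (inj₂ (a≤v , b≤v))
... | inj₁ v≤a | inj₂ _   | inj₁ v≤c = inj₂ (inj₁ (inj₁ (v≤a , v≤c)))
... | inj₂ a≤v | inj₁ _   | inj₂ c≤v = inj₂ (inj₁ (inj₂ (a≤v , c≤v)))
... | inj₁ _   | inj₂ b≤v | inj₂ c≤v = inj₂ (inj₂ (inj₂ (b≤v , c≤v)))
... | inj₂ _   | inj₁ v≤b | inj₁ v≤c = inj₂ (inj₂ (inj₁ (v≤b , v≤c)))

≢⇒xor≡true : ∀ {x y} → x ≢ y → x xor y ≡ true
≢⇒xor≡true {false} {false} x≢y = ⊥-elim (x≢y refl)
≢⇒xor≡true {false} {true}  _   = refl
≢⇒xor≡true {true}  {false} _   = refl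
≢⇒xor≡true {true}  {true}  x≢y = ⊥-elim (x≢y refl)

module TreePaths (Tr : Tree) where
  open Tree Tr

  walk-prefix : ∀ {u w y xs} → Walk adj u w xs → y ∈ xs →
                ∃[ ps ] ∃[ qs ] (Walk adj u y ps × xs ≡ ps ++ qs)
  walk-prefix here          (here refl) = _ , [] , here , refl
  walk-prefix (there _ _)   (here refl) = _ , _ , here , refl
  walk-prefix (there u~ wk) (there y∈)  with walk-prefix wk y∈
  ... | ps , qs , wk′ , refl = _ ∷ ps , qs , there u~ wk′ , refl

  noChord : ∀ {u w s rest y} → IsPath adj u w (u ∷ s ∷ rest) → y ∈ rest → ¬ Adj adj y u
  noChord (there u~s (there s~x wk) , uniq) y∈ with walk-prefix wk y∈
  ... | ps , _ , wk′ , refl =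
    acyclic _ _ _ (there u~s (there s~x wk′) , unique-++⁻ˡ (_ ∷ _ ∷ ps) uniq) (s≤s (s≤s (walk-length wk′)))
    where
    walk-length : ∀ {a b xs} → Walk adj a b xs → 1 ℕ.≤ length xs
    walk-length here        = s≤s z≤n
    walk-length (there _ _) = s≤s z≤n

  prepend : ∀ {p v w f rest} → Adj adj p v → w ≢ p →
            IsPath adj v f (v ∷ w ∷ rest) → IsPath adj p f (p ∷ v ∷ w ∷ rest)
  prepend {p} p~v w≢p path@(wk , uniq) = there p~v wk , unique-∷ p∉ uniq
    where
    p∉ : p ∉ _
    p∉ (here refl)         = adj-irr p p~v
    p∉ (there (here refl)) = w≢p refl
    p∉ (there (there p∈))  = noChord path p∈ p~v

  private
    neighbours : Fin n → List (Fin n)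
    neighbours x = filterᵇ (adj x) (allFin n)

    ∈-neighbours⁺ : ∀ {x y} → Adj adj x y → y ∈ neighbours x
    ∈-neighbours⁺ {x} {y} = ∈-filter⁺ (T? ∘ adj x) (∈-allFin y)

  otherNeighbour : ∀ {x s} → Adj adj x s → ¬ IsLeaf adj x → ∃[ y ] (Adj adj x y × y ≢ s)
  otherNeighbour {x} x~s notLeaf with anotherMember (filter⁺ (T? ∘ adj x) (allFin⁺ n)) notLeaf (∈-neighbours⁺ x~s)
  ... | y , y∈ , y≢s = y , proj₂ (∈-filter⁻ (T? ∘ adj x) {xs = allFin n} y∈) , y≢s

  noOtherNeighbour⇒IsLeaf : ∀ {v p} → Adj adj v p → (∀ y → Adj adj v y → y ≢ p → ⊥) → IsLeaf adj v
  noOtherNeighbour⇒IsLeaf {v} v~p noOther with degree adj v ℕ.≟ 1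
  ... | yes isLeaf = isLeaf
  ... | no notLeaf with otherNeighbour v~p notLeaf
  ...   | y , v~y , y≢p = ⊥-elim (noOther y v~y y≢p)

  path-adj : ∀ {x s b rest} → IsPath adj x b (x ∷ s ∷ rest) → Adj adj x s
  path-adj (there x~s here        , _) = x~s
  path-adj (there x~s (there _ _) , _) = x~s

  LeafExtension : Fin n → List (Fin n) → Set
  LeafExtension b xs = ∃[ g ] ∃[ pre ] (IsLeaf adj g × IsPath adj g b (pre ++ xs))

  -- A path has at most n vertices, so n steps of fuel suffice.
  extendToLeaf′ : ∀ fuel {x s b rest} → n < length (x ∷ s ∷ rest) ℕ.+ fuel →
                  IsPath adj x b (x ∷ s ∷ rest) → LeafExtension b (x ∷ s ∷ rest)
  extendToLeaf′ fuel {x} bound path with degree adj x ℕ.≟ 1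
  ... | yes isLeaf = x , [] , isLeaf , path
  extendToLeaf′ zero bound (_ , uniq) | no _ =
    ⊥-elim (ℕ.<⇒≱ bound (subst (ℕ._≤ n) (sym (ℕ.+-identityʳ _)) (unique⇒length≤ uniq)))
  extendToLeaf′ (suc fuel) {x} bound path | no notLeaf
    with otherNeighbour (path-adj path) notLeaf
  ... | y , x~y , y≢s
    with extendToLeaf′ fuel (subst (n <_) (ℕ.+-suc _ fuel) bound)
                            (prepend (adj-sym x y x~y) (≢-sym y≢s) path)
  ... | g , pre , isLeaf , path′ =
    g , pre ++ [ y ] , isLeaf , subst (IsPath adj g _) (sym (++-assoc pre [ y ] _)) path′

  extendToLeaf : ∀ {x s b rest} → IsPath adj x b (x ∷ s ∷ rest) → LeafExtension b (x ∷ s ∷ rest)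
  extendToLeaf = extendToLeaf′ n (ℕ.m<n+m n (s≤s z≤n))

module SModelProperties {Tr : Tree} (N : SModel Tr) where
  open Tree Tr
  open SModel N
  open TreePaths Tr

  bends-∷ : ∀ a ys → bends N ys ℕ.≤ bends N (a ∷ ys)
  bends-∷ a []           = z≤n
  bends-∷ a (_ ∷ [])     = z≤n
  bends-∷ a (_ ∷ _ ∷ _)  = ℕ.m≤n+m _ _

  bends-++ : ∀ xs ys → bends N ys ℕ.≤ bends N (xs ++ ys)
  bends-++ []       ys = ℕ.≤-refl
  bends-++ (x ∷ xs) ys = ℕ.≤-trans (bends-++ xs ys) (bends-∷ x (xs ++ ys))

  Turn : Fin n → Fin n → Fin n → Set
  Turn a b c = isHor N a b xor isHor N b c ≡ true

  bends-turn : ∀ {a b c} xs → Turn a b c → bends N (a ∷ b ∷ c ∷ xs) ≡ suc (bends N (b ∷ c ∷ xs))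
  bends-turn xs turn rewrite turn = refl

  isHor⇒≡y : ∀ {a b} → isHor N a b ≡ true → proj₂ (pos a) ≡ proj₂ (pos b)
  isHor⇒≡y {a} {b} _  with proj₂ (pos a) ℤ.≟ proj₂ (pos b)
  isHor⇒≡y         _  | yes ya≡yb = ya≡yb
  isHor⇒≡y         () | no _

  ¬isHor⇒≡x : ∀ {a b} → Adj adj a b → isHor N a b ≡ false → proj₁ (pos a) ≡ proj₁ (pos b)
  ¬isHor⇒≡x {a} {b} a~b _ with straight a b a~b | proj₂ (pos a) ℤ.≟ proj₂ (pos b)
  ¬isHor⇒≡x         _   _  | inj₁ xa≡xb | _        = xa≡xb
  ¬isHor⇒≡x         _   () | inj₂ _     | yes _
  ¬isHor⇒≡x         _   _  | inj₂ ya≡yb | no ya≢yb = ⊥-elim (ya≢yb ya≡yb)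

  notOnNeighbourEdge : ∀ {v a b} → Adj adj v a → Adj adj v b → a ≢ b → ¬ OnSeg (pos v) (pos b) (pos a)
  notOnNeighbourEdge {v} {a} {b} v~a v~b a≢b a∈vb
    with meet v a v b (pos a) v~a v~b sameEdge (Between-right _ _ , Between-right _ _) a∈vb
    where
    sameEdge : ¬ (((v ≡ v) × (a ≡ b)) ⊎ ((v ≡ b) × (a ≡ v)))
    sameEdge (inj₁ (_ , a≡b)) = a≢b a≡b
    sameEdge (inj₂ (_ , refl)) = adj-irr v v~a
  ... | _ , inj₁ refl , _         , pa≡pv = adj-irr v (subst (Adj adj v) (pos-inj a v pa≡pv) v~a)
  ... | _ , inj₂ refl , inj₁ refl , _     = adj-irr v v~a
  ... | _ , inj₂ refl , inj₂ refl , _     = a≢b refl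

  module _ (X Y : Point → ℤ)
           (onSeg : ∀ {a b q} → Between (X a) (X b) (X q) → Between (Y a) (Y b) (Y q) → OnSeg a b q) where

    neighboursOnOneSide : ∀ {v s t} → Adj adj v s → Adj adj v t → s ≢ t →
                          Y (pos s) ≡ Y (pos v) → Y (pos t) ≡ Y (pos v) →
                          ¬ SameSide (X (pos v)) (X (pos s)) (X (pos t))
    neighboursOnOneSide v~s v~t s≢t ys yt side with sameSide⇒nested side
    ... | inj₁ s∈vt = notOnNeighbourEdge v~s v~t s≢t (onSeg s∈vt (Between-≡ ys yt))
    ... | inj₂ t∈vs = notOnNeighbourEdge v~t v~s (≢-sym s≢t) (onSeg t∈vs (Between-≡ yt ys))

    noThreeNeighboursOnLine : ∀ {v a b c} → Adj adj v a → Adj adj v b → Adj adj v c →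
                              a ≢ b → a ≢ c → b ≢ c →
                              Y (pos a) ≡ Y (pos v) → Y (pos b) ≡ Y (pos v) → Y (pos c) ≡ Y (pos v) → ⊥
    noThreeNeighboursOnLine {v} {a} {b} {c} v~a v~b v~c a≢b a≢c b≢c ya yb yc
      with twoOnSameSide (X (pos v)) (X (pos a)) (X (pos b)) (X (pos c))
    ... | inj₁ ab        = neighboursOnOneSide v~a v~b a≢b ya yb ab
    ... | inj₂ (inj₁ ac) = neighboursOnOneSide v~a v~c a≢c ya yc ac
    ... | inj₂ (inj₂ bc) = neighboursOnOneSide v~b v~c b≢c yb yc bc

  threeParallelEdges : ∀ {p v w₁ w₂} → Adj adj p v → Adj adj v w₁ → Adj adj v w₂ →
                       w₁ ≢ p → w₂ ≢ p → w₁ ≢ w₂ →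
                       isHor N p v ≡ isHor N v w₁ → isHor N p v ≡ isHor N v w₂ → ⊥
  threeParallelEdges {p} {v} p~v v~w₁ v~w₂ w₁≢p w₂≢p w₁≢w₂ e₁ e₂ with isHor N p v in horizontal
  ... | true  = noThreeNeighboursOnLine proj₁ proj₂ _,_
                  (adj-sym p v p~v) v~w₁ v~w₂ (≢-sym w₁≢p) (≢-sym w₂≢p) w₁≢w₂
                  (isHor⇒≡y horizontal) (sym (isHor⇒≡y (sym e₁))) (sym (isHor⇒≡y (sym e₂)))
  ... | false = noThreeNeighboursOnLine proj₂ proj₁ (λ x∈ y∈ → y∈ , x∈)
                  (adj-sym p v p~v) v~w₁ v~w₂ (≢-sym w₁≢p) (≢-sym w₂≢p) w₁≢w₂
                  (¬isHor⇒≡x p~v horizontal) (sym (¬isHor⇒≡x v~w₁ (sym e₁))) (sym (¬isHor⇒≡x v~w₂ (sym e₂)))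

  turnAt : ∀ {p v w₁ w₂} → Adj adj p v → Adj adj v w₁ → Adj adj v w₂ →
           w₁ ≢ p → w₂ ≢ p → w₁ ≢ w₂ → Turn p v w₁ ⊎ Turn p v w₂
  turnAt {p} {v} {w₁} {w₂} p~v v~w₁ v~w₂ w₁≢p w₂≢p w₁≢w₂
    with isHor N p v ≟ᵇ isHor N v w₁ | isHor N p v ≟ᵇ isHor N v w₂
  ... | no ≢₁  | _      = inj₁ (≢⇒xor≡true ≢₁)
  ... | yes _  | no ≢₂  = inj₂ (≢⇒xor≡true ≢₂)
  ... | yes e₁ | yes e₂ = ⊥-elim (threeParallelEdges p~v v~w₁ v~w₂ w₁≢p w₂≢p w₁≢w₂ e₁ e₂)

  record LeafPath≥ (p v : Fin n) (k : ℤ) : Set where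
    constructor leafPath
    field
      {leaf} : Fin n
      {rest} : List (Fin n)
      isLeaf : IsLeaf adj leaf
      path   : IsPath adj p leaf (p ∷ v ∷ rest)
      bound  : k ≤ + bends N (p ∷ v ∷ rest)

  leafPath-mono : ∀ {p v k k′} → k′ ≤ k → LeafPath≥ p v k → LeafPath≥ p v k′
  leafPath-mono k′≤k (leafPath isLeaf path bound) = leafPath isLeaf path (ℤ.≤-trans k′≤k bound)

  leafPath-edge : ∀ {p v} → Adj adj p v → IsLeaf adj v → LeafPath≥ p v (+ 0)
  leafPath-edge {p} p~v isLeaf = leafPath isLeaf (there p~v here , unique-∷ p∉ (unique-∷ (λ ()) [])) (+≤+ z≤n)
    where
    p∉ : p ∉ _
    p∉ (here refl) = adj-irr p p~v

  leafPath-∷ : ∀ {p v w k} → Adj adj p v → w ≢ p → LeafPath≥ v w k → LeafPath≥ p v k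
  leafPath-∷ {p} {v} {w} p~v w≢p (leafPath {rest = rest} isLeaf path bound) =
    leafPath isLeaf (prepend p~v w≢p path) (ℤ.≤-trans bound (+≤+ (bends-∷ p (v ∷ w ∷ rest))))

  leafPath-∷-turn : ∀ {p v w k} → Adj adj p v → w ≢ p → Turn p v w → LeafPath≥ v w k → LeafPath≥ p v (+ 1 ℤ.+ k)
  leafPath-∷-turn {k = k} p~v w≢p turn (leafPath {rest = rest} isLeaf path bound) =
    leafPath isLeaf (prepend p~v w≢p path)
      (subst (λ m → + 1 ℤ.+ k ≤ + m) (sym (bends-turn rest turn)) (ℤ.+-monoʳ-≤ (+ 1) bound))

  leafPath⇒≤ : ∀ {p v k b} → IsBModel N b → LeafPath≥ p v k → k ≤ + b
  leafPath⇒≤ (maximal , _) (leafPath isLeaf path bound) with extendToLeaf path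
  ... | _ , pre , isLeaf′ , path′ =
    ℤ.≤-trans bound (+≤+ (ℕ.≤-trans (bends-++ pre _) (maximal _ (_ , _ , _ , isLeaf′ , isLeaf , path′ , refl))))

IsMax-unique : ∀ {S : ℕ → Set} {a b} → IsMax S a → IsMax S b → a ≡ b
IsMax-unique (a-upper , inj₁ Sa)       (b-upper , inj₁ Sb)       = ℕ.≤-antisym (b-upper _ Sa) (a-upper _ Sb)
IsMax-unique (_       , inj₁ Sa)       (_       , inj₂ (_ , ¬S)) = ⊥-elim (¬S _ Sa)
IsMax-unique (_       , inj₂ (_ , ¬S)) (_       , inj₁ Sb)       = ⊥-elim (¬S _ Sb)
IsMax-unique (_       , inj₂ (a≡0 , _)) (_      , inj₂ (b≡0 , _)) = trans a≡0 (sym b≡0)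

module CriticalPairs {Tr : Tree} (M N : SModel Tr) where
  open Tree Tr
  open TreePaths Tr
  open SModelProperties N

  BL-unique : ∀ {p v k k′} → BL M p (just v) k → BL M p (just v) k′ → k ≡ k′
  BL-unique (_ , refl , max) (_ , refl , max′) = cong +_ (IsMax-unique max max′)

  BL-nonneg : ∀ {p v k} → BL M p (just v) k → + 0 ≤ k
  BL-nonneg (_ , refl , _) = +≤+ z≤n

  first : ∀ {p v w u₂ u₃ b₁ b₂ b₃} → Ordering M p v (just w) u₂ u₃ b₁ b₂ b₃ → Adj adj v w × w ≢ p
  first ord = Padding.sound (Ordering.padding ord) _ (inj₁ refl)

  second : ∀ {p v w u₁ u₃ b₁ b₂ b₃} → Ordering M p v u₁ (just w) u₃ b₁ b₂ b₃ → Adj adj v w × w ≢ p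
  second ord = Padding.sound (Ordering.padding ord) _ (inj₂ (inj₁ refl))

  first≢second : ∀ {p v w₁ w₂ u₃ b₁ b₂ b₃} → Ordering M p v (just w₁) (just w₂) u₃ b₁ b₂ b₃ → w₁ ≢ w₂
  first≢second ord w₁≡w₂ = Padding.dist12 (Ordering.padding ord) _ refl (cong just w₁≡w₂)

  -- The third slot cannot hold a real neighbour, as its value would be below b² = -1.
  noNeighbourBeyond : ∀ {p v u₃ b₁ b₂ b₃} → Ordering M p v nothing nothing u₃ b₁ b₂ b₃ →
                      ∀ y → Adj adj v y → y ≢ p → ⊥
  noNeighbourBeyond record { padding = pad ; val2 = refl ; val3 = val3 ; ord23 = b₃≤b₂ } y v~y y≢p
    with Padding.complete pad y v~y y≢p
  ... | inj₁ ()
  ... | inj₂ (inj₁ ())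
  ... | inj₂ (inj₂ refl) with val3 | b₃≤b₂
  ...   | _ , refl , _ | ()

  criticalValue : ∀ {p v} → Critical M p (just v) → ℤ
  criticalValue (crit-a _ _ _ k _ _ _ _ _ _ _ _)   = k
  criticalValue (crit-b _ _ _ k _ _ _ _ _ _ _ _ _) = k

  criticalValue-BL : ∀ {p v} (c : Critical M p (just v)) → BL M p (just v) (criticalValue c)
  criticalValue-BL (crit-a _ _ _ _ _ _ _ _ _ bl _ _)   = bl
  criticalValue-BL (crit-b _ _ _ _ _ _ _ _ _ bl _ _ _) = bl

  criticalLeafPath : ∀ {p v k} → Critical M p (just v) → BL M p (just v) k → LeafPath≥ p v k
  criticalLeafPath′ : ∀ {p v} (c : Critical M p (just v)) → LeafPath≥ p v (criticalValue c)

  criticalLeafPath c bl = subst (LeafPath≥ _ _) (BL-unique (criticalValue-BL c) bl) (criticalLeafPath′ c)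

  criticalLeafPath′ (crit-a nothing _ _ _ _ _ _ _ record { val1 = refl } (_ , () , _) refl _)
  criticalLeafPath′ (crit-a (just w) _ _ _ _ _ _ p~v ord _ refl c₁) =
    leafPath-∷ p~v (proj₂ (first ord)) (criticalLeafPath c₁ (Ordering.val1 ord))
  criticalLeafPath′ {p} {v} (crit-b nothing nothing _ _ _ _ _ p~v ord@record { val2 = refl } _ refl _ _) =
    leafPath-edge p~v (noOtherNeighbour⇒IsLeaf (adj-sym p v p~v) (noNeighbourBeyond ord))
  criticalLeafPath′ (crit-b nothing (just _) _ _ _ _ _ _ record { val1 = refl ; val2 = (_ , refl , _) ; ord12 = () } _ refl _ _)
  criticalLeafPath′ (crit-b (just w) nothing _ _ _ _ _ p~v ord@record { val2 = refl } _ refl c₁ _) =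
    leafPath-mono (BL-nonneg (Ordering.val1 ord))
      (leafPath-∷ p~v (proj₂ (first ord)) (criticalLeafPath c₁ (Ordering.val1 ord)))
  criticalLeafPath′ (crit-b (just w₁) (just w₂) _ _ b₁ b₂ _ p~v ord _ refl c₁ c₂)
    with turnAt p~v (proj₁ (first ord)) (proj₁ (second ord)) (proj₂ (first ord)) (proj₂ (second ord)) (first≢second ord)
  ... | inj₁ turn = leafPath-mono (ℤ.≤-trans (ℤ.≤-reflexive (ℤ.+-comm b₂ (+ 1))) (ℤ.+-monoʳ-≤ (+ 1) (Ordering.ord12 ord)))
                      (leafPath-∷-turn p~v (proj₂ (first ord)) turn (criticalLeafPath c₁ (Ordering.val1 ord)))
  ... | inj₂ turn = leafPath-mono (ℤ.≤-reflexive (ℤ.+-comm b₂ (+ 1)))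
                      (leafPath-∷-turn p~v (proj₂ (second ord)) turn (criticalLeafPath c₂ (Ordering.val2 ord)))

corollary1 : (T : Tree) → MaxDeg≤4 T → (M : SModel T) →
             (p : Fin (Tree.n T)) (v : Maybe (Fin (Tree.n T))) →
             Critical M p v →
             (k : ℤ) → BL M p v k →
             (bT : ℕ) → IsBTree T bT →
             k ≤ + bT
corollary1 T _ M p nothing  _        k refl bT _              = -≤+
corollary1 T _ M p (just v) critical k bl   bT ((N , bN) , _) =
  SModelProperties.leafPath⇒≤ N bN (CriticalPairs.criticalLeafPath M N critical bl)
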